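{- Let $L$ be a second-order language and $E$ a set of equations of $L$, and consider the typing system $\mathcal{AF}2$ determined by $L$ and $E$. Let $\Gamma$ be a context, $u$ a $\lambda$-term, $B$ a formula of $L$, $x$ an individual variable and $a,b$ terms of $L$. If $\Gamma\vdash_{\mathcal{AF}2} u : B[a/x]$ and $a\approx_E b$, then $\Gamma\vdash_{\mathcal{AF}2} u : B[b/x]$.
   Context: Formulas of $L$ are those of second-order intuitionistic predicate calculus built with only $\rightarrow$ and $\forall$, from individual (first-order) variables $x,y,\dots$, $n$-ary relation variables $X,Y,\dots$ (infinitely many of each arity), and the function and relation symbols of $L$. For a unary relation variable $X$ and terms $t,t'$, the formula $\forall X[Xt\rightarrow Xt']$ is written $t=t'$ and called an equation. A particular case of the equation $t=t'$ is a formula $t[u_1/x_1,\dots,u_n/x_n]=t'[u_1/x_1,\dots,u_n/x_n]$ or $t'[u_1/x_1,\dots,u_n/x_n]=t[u_1/x_1,\dots,u_n/x_n]$ with $u_i$ terms of $L$. A context is a finite set $x_1:A_1,\dots,x_n:A_n$ of declarations with distinct $\lambda$-variables $x_i$ and formulas $A_i$. The judgement $\Gamma\vdash_{\mathcal{AF}2} t:A$ is defined by the rules: (1) $\Gamma\vdash x_i:A_i$ for $(x_i:A_i)\in\Gamma$; (2) from $\Gamma,x:A\vdash t:B$ infer $\Gamma\vdash\lambda x t:A\rightarrow B$; (3) from $\Gamma\vdash u:A\rightarrow B$ and $\Gamma\vdash v:A$ infer $\Gamma\vdash (u)v:B$; (4) from $\Gamma\vdash t:A$ infer $\Gamma\vdash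 t:\forall xA$ if $x$ is not free in $\Gamma$; (5) from $\Gamma\vdash t:\forall xA$ infer $\Gamma\vdash t:A[u/x]$ for any term $u$; (6) from $\Gamma\vdash t:A$ infer $\Gamma\vdash t:\forall XA$ if $X$ is not free in $\Gamma$; (7) from $\Gamma\vdash t:\forall XA$ infer $\Gamma\vdash t:A[F/X(x_1,\dots,x_n)]$ for any formula $F$, where this denotes replacing each atomic $X(t_1,\dots,t_n)$ in $A$ by $F[t_1/x_1,\dots,t_n/x_n]$; (8) from $\Gamma\vdash t:A[u/x]$ infer $\Gamma\vdash t:A[v/x]$ whenever $u=v$ is a particular case of an equation of $E$. For terms $a,b$ of $L$, $a\approx_E b$ means $E\vdash a=b$ (derivability in second-order intuitionistic logic); equivalently, $\approx_E$ is the smallest relation containing all pairs $(a,b)$ with $a=b$ a particular case of an equation of $E$, which is reflexive and transitive and satisfies $f(a_1,\dots,a_n)\approx_E f(b_1,\dots,b_n)$ whenever $a_i\approx_E b_i$ for all $i$. -}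

module Defs where

open import Data.Nat using (ℕ; zero; suc; _≟_)
open import Data.Fin using (Fin; zero; suc)
open import Data.Vec using (Vec; []; _∷_; toList)
open import Data.List using (List; []; _∷_)
open import Data.List.Relation.Unary.Any using (Any; here; there)
open import Data.List.Relation.Unary.All using (All)
open import Data.List.Relation.Unary.Unique.Propositional using (Unique)
open import Data.Vec.Relation.Binary.Pointwise.Inductive using (Pointwise)
open import Data.Sum using (_⊎_; inj₁; inj₂)
open import Data.Product using (Σ; _×_; _,_)
open import Data.Bool using (Bool; true; false; _∨_; _∧_)
open import Relation.Nullary using (yes; no)
open import Relation.Binary.PropositionalEquality using (_≡_; refl)

infix 4 _∈_
_∈_ : ℕ → List ℕ → Set
n ∈ Δ = Any (n ≡_) Δ

record Language : Set₁ where
  field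
    Fun   : Set
    funAr : Fun → ℕ
    Rel   : Set
    relAr : Rel → ℕ

-- Syntax (locally nameless).
-- Free individual variables are named by ℕ; bound individual variables
-- are de Bruijn indices (Fin k, k = number of enclosing ∀₁ binders).
-- Free n-ary relation variables are named by (n , X : ℕ); bound relation
-- variables are de Bruijn pointers n ∈ Δ into the list Δ of arities of
-- the enclosing ∀₂ binders.  Terms of L are Term 0, formulas of L are
-- Formula 0 [].

module Syntax (L : Language) where
  open Language L

  data Term (k : ℕ) : Set where
    bv : Fin k → Term k
    fv : ℕ → Term k
    fn : (f : Fun) → Vec (Term k) (funAr f) → Term k

  infixr 6 _⇒_
  data Formula (k : ℕ) (Δ : List ℕ) : Set where
    rel : (R : Rel) → Vec (Term k) (relAr R) → Formula k Δ
    fX  : (n X : ℕ) → Vec (Term k) n → Formula k Δ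
    bX  : ∀ {n} → n ∈ Δ → Vec (Term k) n → Formula k Δ
    _⇒_ : Formula k Δ → Formula k Δ → Formula k Δ
    ∀₁  : Formula (suc k) Δ → Formula k Δ
    ∀₂  : (n : ℕ) → Formula k (n ∷ Δ) → Formula k Δ

  TSub : ℕ → ℕ → Set
  TSub k k' = Fin k ⊎ ℕ → Term k'

  mutual
    subT : ∀ {k k'} → TSub k k' → Term k → Term k'
    subT σ (bv i) = σ (inj₁ i)
    subT σ (fv x) = σ (inj₂ x)
    subT σ (fn f ts) = fn f (subTs σ ts)

    subTs : ∀ {k k' n} → TSub k k' → Vec (Term k) n → Vec (Term k') n
    subTs σ [] = []
    subTs σ (t ∷ ts) = subT σ t ∷ subTs σ ts

  wkT : ∀ {k} → Term k → Term (suc k)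
  wkT = subT λ { (inj₁ i) → bv (suc i) ; (inj₂ x) → fv x }

  liftT : ∀ {k k'} → TSub k k' → TSub (suc k) (suc k')
  liftT σ (inj₁ zero) = bv zero
  liftT σ (inj₁ (suc i)) = wkT (σ (inj₁ i))
  liftT σ (inj₂ x) = wkT (σ (inj₂ x))

  subF : ∀ {k k' Δ} → TSub k k' → Formula k Δ → Formula k' Δ
  subF σ (rel R ts) = rel R (subTs σ ts)
  subF σ (fX n X ts) = fX n X (subTs σ ts)
  subF σ (bX p ts) = bX p (subTs σ ts)
  subF σ (A ⇒ B) = subF σ A ⇒ subF σ B
  subF σ (∀₁ A) = ∀₁ (subF (liftT σ) A)
  subF σ (∀₂ n A) = ∀₂ n (subF σ A)

  liftR : ∀ {m Δ Δ'} → (∀ {n} → n ∈ Δ → n ∈ Δ') → ∀ {n} → n ∈ (m ∷ Δ) → n ∈ (m ∷ Δ')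
  liftR ρ (here p) = here p
  liftR ρ (there q) = there (ρ q)

  renR : ∀ {k Δ Δ'} → (∀ {n} → n ∈ Δ → n ∈ Δ') → Formula k Δ → Formula k Δ'
  renR ρ (rel R ts) = rel R ts
  renR ρ (fX n X ts) = fX n X ts
  renR ρ (bX p ts) = bX (ρ p) ts
  renR ρ (A ⇒ B) = renR ρ A ⇒ renR ρ B
  renR ρ (∀₁ A) = ∀₁ (renR ρ A)
  renR ρ (∀₂ n A) = ∀₂ n (renR (liftR ρ) A)

  SSub : List ℕ → List ℕ → Set
  SSub Δ Δ' = ∀ {n} → n ∈ Δ → ∀ {k} → Vec (Term k) n → Formula k Δ'

  liftS : ∀ {m Δ Δ'} → SSub Δ Δ' → SSub (m ∷ Δ) (m ∷ Δ')
  liftS ρ (here p) ts = bX (here p) ts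
  liftS ρ (there q) ts = renR there (ρ q ts)

  subS : ∀ {k Δ Δ'} → SSub Δ Δ' → Formula k Δ → Formula k Δ'
  subS ρ (rel R ts) = rel R ts
  subS ρ (fX n X ts) = fX n X ts
  subS ρ (bX p ts) = ρ p ts
  subS ρ (A ⇒ B) = subS ρ A ⇒ subS ρ B
  subS ρ (∀₁ A) = ∀₁ (subS ρ A)
  subS ρ (∀₂ n A) = ∀₂ n (subS (liftS ρ) A)

  emb : ∀ {k} → Term 0 → Term k
  emb = subT λ { (inj₁ ()) ; (inj₂ x) → fv x }

  sing : ∀ {k} → Term 0 → ℕ → TSub k k
  sing a x (inj₁ i) = bv i
  sing a x (inj₂ y) with y ≟ x
  ... | yes _ = emb a
  ... | no _ = fv y

  _[_/_] : ∀ {k Δ} → Formula k Δ → Term 0 → ℕ → Formula k Δ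
  A [ a / x ] = subF (sing a x) A

  _[_]ₜ : Term 0 → (ℕ → Term 0) → Term 0
  t [ σ ]ₜ = subT (λ { (inj₁ ()) ; (inj₂ y) → σ y }) t

  abs₁ : ∀ {k Δ} → ℕ → Formula k Δ → Formula (suc k) Δ
  abs₁ x = subF σ
    where
    σ : TSub _ (suc _)
    σ (inj₁ i) = bv (suc i)
    σ (inj₂ y) with y ≟ x
    ... | yes _ = bv zero
    ... | no _ = fv y

  inst₁ : ∀ {k Δ} → Formula (suc k) Δ → Term k → Formula k Δ
  inst₁ A u = subF σ A
    where
    σ : TSub (suc _) _
    σ (inj₁ zero) = u
    σ (inj₁ (suc i)) = bv i
    σ (inj₂ y) = fv y

  absR' : ∀ {k Δ Δ'} (n X : ℕ) → n ∈ Δ' → (∀ {m} → m ∈ Δ → m ∈ Δ') →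
          Formula k Δ → Formula k Δ'
  absR' n X ι ρ (rel R ts) = rel R ts
  absR' n X ι ρ (fX m Y ts) with m ≟ n | Y ≟ X
  ... | yes refl | yes _ = bX ι ts
  ... | _ | _ = fX m Y ts
  absR' n X ι ρ (bX p ts) = bX (ρ p) ts
  absR' n X ι ρ (A ⇒ B) = absR' n X ι ρ A ⇒ absR' n X ι ρ B
  absR' n X ι ρ (∀₁ A) = ∀₁ (absR' n X ι ρ A)
  absR' n X ι ρ (∀₂ m A) = ∀₂ m (absR' n X (there ι) (liftR ρ) A)

  absR : ∀ {k Δ} (n X : ℕ) → Formula k Δ → Formula k (n ∷ Δ)
  absR n X = absR' n X (here refl) there

  assoc : ∀ {k m} → ℕ → Vec ℕ m → Vec (Term k) m → Term k
  assoc y [] [] = fv y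
  assoc y (x ∷ xs) (t ∷ ts) with y ≟ x
  ... | yes _ = t
  ... | no _ = assoc y xs ts

  -- A [ F / X(x₁,…,xₙ) ] where ∀X A is given in abstracted form
  inst₂ : ∀ {n} → Formula 0 (n ∷ []) → Formula 0 [] → Vec ℕ n → Formula 0 []
  inst₂ {n} A F xs = subS ρ A
    where
    ρ : SSub (n ∷ []) []
    ρ (here refl) ts = subF (λ { (inj₁ ()) ; (inj₂ y) → assoc y xs ts }) F
    ρ (there ())

  mutual
    occT : ∀ {k} → ℕ → Term k → Bool
    occT x (bv i) = false
    occT x (fv y) with y ≟ x
    ... | yes _ = true
    ... | no _ = false
    occT x (fn f ts) = occTs x ts

    occTs : ∀ {k n} → ℕ → Vec (Term k) n → Bool
    occTs x [] = false
    occTs x (t ∷ ts) = occT x t ∨ occTs x ts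

  occF : ∀ {k Δ} → ℕ → Formula k Δ → Bool
  occF x (rel R ts) = occTs x ts
  occF x (fX n X ts) = occTs x ts
  occF x (bX p ts) = occTs x ts
  occF x (A ⇒ B) = occF x A ∨ occF x B
  occF x (∀₁ A) = occF x A
  occF x (∀₂ n A) = occF x A

  occR : ∀ {k Δ} → ℕ → ℕ → Formula k Δ → Bool
  occR n X (rel R ts) = false
  occR n X (fX m Y ts) with m ≟ n | Y ≟ X
  ... | yes _ | yes _ = true
  ... | _ | _ = false
  occR n X (bX p ts) = false
  occR n X (A ⇒ B) = occR n X A ∨ occR n X B
  occR n X (∀₁ A) = occR n X A
  occR n X (∀₂ m A) = occR n X A

-- λ-terms (de Bruijn, i.e. up to α-conversion), contexts

data Λ : Set where
  var : ℕ → Λ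
  lam : Λ → Λ
  app : Λ → Λ → Λ

-- The typing system AF2 determined by L and a set E of equations.
-- An equation t = t' (the formula ∀X[Xt → Xt']) is represented by the
-- pair (t , t') of terms of L; E is a set of such pairs.

module AF2 (L : Language) (E : Syntax.Term L 0 → Syntax.Term L 0 → Set) where
  open Syntax L

  Fm : Set
  Fm = Formula 0 []

  -- a context: the i-th entry declares the λ-variable var i
  Ctx : Set
  Ctx = List Fm

  data _∋_∶_ : Ctx → ℕ → Fm → Set where
    here  : ∀ {Γ A} → (A ∷ Γ) ∋ 0 ∶ A
    there : ∀ {Γ A B i} → Γ ∋ i ∶ A → (B ∷ Γ) ∋ suc i ∶ A

  PartCase : Term 0 → Term 0 → Set
  PartCase u v = Σ (Term 0) λ t → Σ (Term 0) λ t' → E t t' ×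
                 Σ (ℕ → Term 0) λ σ →
                 ((u ≡ t [ σ ]ₜ) × (v ≡ t' [ σ ]ₜ)) ⊎ ((u ≡ t' [ σ ]ₜ) × (v ≡ t [ σ ]ₜ))

  infix 4 _≈_
  data _≈_ : Term 0 → Term 0 → Set where
    ≈-base  : ∀ {a b} → PartCase a b → a ≈ b
    ≈-refl  : ∀ {a} → a ≈ a
    ≈-trans : ∀ {a b c} → a ≈ b → b ≈ c → a ≈ c
    ≈-cong  : ∀ f {as bs} → Pointwise _≈_ as bs → fn f as ≈ fn f bs

  infix 3 _⊢_∶_
  data _⊢_∶_ : Ctx → Λ → Fm → Set where
    ax  : ∀ {Γ i A} → Γ ∋ i ∶ A → Γ ⊢ var i ∶ A
    ⇒I  : ∀ {Γ t A B} → (A ∷ Γ) ⊢ t ∶ B → Γ ⊢ lam t ∶ A ⇒ B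
    ⇒E  : ∀ {Γ u v A B} → Γ ⊢ u ∶ A ⇒ B → Γ ⊢ v ∶ A → Γ ⊢ app u v ∶ B
    ∀₁I : ∀ {Γ t A} (x : ℕ) → All (λ C → occF x C ≡ false) Γ →
          Γ ⊢ t ∶ A → Γ ⊢ t ∶ ∀₁ (abs₁ x A)
    ∀₁E : ∀ {Γ t A} → Γ ⊢ t ∶ ∀₁ A → (u : Term 0) → Γ ⊢ t ∶ inst₁ A u
    ∀₂I : ∀ {Γ t A} (n X : ℕ) → All (λ C → occR n X C ≡ false) Γ →
          Γ ⊢ t ∶ A → Γ ⊢ t ∶ ∀₂ n (absR n X A)
    ∀₂E : ∀ {Γ t n A} → Γ ⊢ t ∶ ∀₂ n A → (F : Fm) (xs : Vec ℕ n) →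
          Unique (toList xs) → Γ ⊢ t ∶ inst₂ A F xs
    eqR : ∀ {Γ t} (A : Fm) (x : ℕ) {u v : Term 0} → PartCase u v →
          Γ ⊢ t ∶ A [ u / x ] → Γ ⊢ t ∶ A [ v / x ]

module Submission where

-- Call a pair (a , b) *transportable* when every derivation of a type
-- B[a/x] yields one of B[b/x] with the same λ-term.  We show that ≈_E-related
-- terms are transportable, by induction on the derivation of a ≈_E b:
-- particular cases of equations of E are exactly the rule eqR, reflexivity
-- and transitivity are immediate, and the congruence case is the real work.
-- For f(a₁,…,aₙ) ≈ f(b₁,…,bₙ) we replace the arguments one at a time: with a
-- variable y fresh for B and all aᵢ, bᵢ we have
--   B[f(b₁,…,bᵢ₋₁,aᵢ,…,aₙ)/x] = (B[f(b₁,…,bᵢ₋₁,y,aᵢ₊₁,…,aₙ)/x])[aᵢ/y],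
-- so the induction hypothesis for aᵢ ≈ bᵢ, used at this larger formula and
-- the variable y, performs the i-th replacement.

open import Defs
open import Data.Nat using (ℕ; suc; _≟_; _⊔_; _<_; s≤s)
open import Data.Nat.Properties using (m⊔n<o⇒m<o; m⊔n<o⇒n<o; <-irrefl; ≤-refl)
open import Data.List using ([])
open import Data.Fin using (zero; suc)
open import Data.Vec using (Vec; []; _∷_)
open import Data.Vec.Relation.Binary.Pointwise.Inductive using (Pointwise; []; _∷_)
open import Data.Sum using (inj₁; inj₂)
open import Data.Empty using (⊥-elim)
open import Relation.Nullary using (yes; no; ¬_)
open import Relation.Binary.PropositionalEquality
  using (_≡_; refl; sym; trans; cong; cong₂; subst; module ≡-Reasoning)

module Substitution (L : Language) where
  open Syntax L

  -- An upper bound on the names of the free individual variables; any y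
  -- above it is fresh.
  mutual
    boundT : ∀ {k} → Term k → ℕ
    boundT (bv i) = 0
    boundT (fv z) = z
    boundT (fn f ts) = boundTs ts

    boundTs : ∀ {k n} → Vec (Term k) n → ℕ
    boundTs [] = 0
    boundTs (t ∷ ts) = boundT t ⊔ boundTs ts

  boundF : ∀ {k Δ} → Formula k Δ → ℕ
  boundF (rel R ts) = boundTs ts
  boundF (fX n X ts) = boundTs ts
  boundF (bX p ts) = boundTs ts
  boundF (A ⇒ B) = boundF A ⊔ boundF B
  boundF (∀₁ A) = boundF A
  boundF (∀₂ n A) = boundF A

  mutual
    subT-square : ∀ {k k₁ k₂ k₃} (σ : TSub k₁ k₃) (τ : TSub k k₂) (e : TSub k k₁) (e' : TSub k₂ k₃) →
                  (∀ v → subT σ (e v) ≡ subT e' (τ v)) →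
                  (t : Term k) → subT σ (subT e t) ≡ subT e' (subT τ t)
    subT-square σ τ e e' square (bv i) = square (inj₁ i)
    subT-square σ τ e e' square (fv z) = square (inj₂ z)
    subT-square σ τ e e' square (fn f ts) = cong (fn f) (subTs-square σ τ e e' square ts)

    subTs-square : ∀ {k k₁ k₂ k₃ n} (σ : TSub k₁ k₃) (τ : TSub k k₂) (e : TSub k k₁) (e' : TSub k₂ k₃) →
                   (∀ v → subT σ (e v) ≡ subT e' (τ v)) →
                   (ts : Vec (Term k) n) → subTs σ (subTs e ts) ≡ subTs e' (subTs τ ts)
    subTs-square σ τ e e' square [] = refl
    subTs-square σ τ e e' square (t ∷ ts) =
      cong₂ _∷_ (subT-square σ τ e e' square t) (subTs-square σ τ e e' square ts)

  wkT-liftT : ∀ {k k'} (σ : TSub k k') (t : Term k) → subT (liftT σ) (wkT t) ≡ wkT (subT σ t)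
  wkT-liftT σ = subT-square (liftT σ) σ _ _ λ { (inj₁ i) → refl ; (inj₂ z) → refl }

  FusesOff : ∀ {k k' k''} → ℕ → TSub k' k'' → TSub k k' → TSub k k'' → Set
  FusesOff y σ τ ρ = ∀ v → ¬ v ≡ inj₂ y → subT σ (τ v) ≡ ρ v

  liftT-fuses : ∀ {k k' k''} {σ : TSub k' k''} {τ : TSub k k'} {ρ : TSub k k''} y →
                FusesOff y σ τ ρ → FusesOff y (liftT σ) (liftT τ) (liftT ρ)
  liftT-fuses y fuses (inj₁ zero) _ = refl
  liftT-fuses {σ = σ} {τ} y fuses (inj₁ (suc i)) _ =
    trans (wkT-liftT σ (τ (inj₁ i))) (cong wkT (fuses (inj₁ i) λ ()))
  liftT-fuses {σ = σ} {τ} y fuses (inj₂ z) z≢y =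
    trans (wkT-liftT σ (τ (inj₂ z))) (cong wkT (fuses (inj₂ z) λ { refl → z≢y refl }))

  mutual
    subT-fuse : ∀ {k k' k''} {σ : TSub k' k''} {τ : TSub k k'} {ρ : TSub k k''} y →
                FusesOff y σ τ ρ → (t : Term k) → boundT t < y →
                subT σ (subT τ t) ≡ subT ρ t
    subT-fuse y fuses (bv i) _ = fuses (inj₁ i) λ ()
    subT-fuse y fuses (fv z) z<y = fuses (inj₂ z) λ { refl → <-irrefl refl z<y }
    subT-fuse y fuses (fn f ts) ts<y = cong (fn f) (subTs-fuse y fuses ts ts<y)

    subTs-fuse : ∀ {k k' k'' n} {σ : TSub k' k''} {τ : TSub k k'} {ρ : TSub k k''} y →
                 FusesOff y σ τ ρ → (ts : Vec (Term k) n) → boundTs ts < y →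
                 subTs σ (subTs τ ts) ≡ subTs ρ ts
    subTs-fuse y fuses [] _ = refl
    subTs-fuse y fuses (t ∷ ts) h =
      cong₂ _∷_ (subT-fuse y fuses t (m⊔n<o⇒m<o (boundT t) _ h))
                (subTs-fuse y fuses ts (m⊔n<o⇒n<o (boundT t) _ h))

  subF-fuse : ∀ {k k' k'' Δ} {σ : TSub k' k''} {τ : TSub k k'} {ρ : TSub k k''} y →
              FusesOff y σ τ ρ → (A : Formula k Δ) → boundF A < y →
              subF σ (subF τ A) ≡ subF ρ A
  subF-fuse y fuses (rel R ts) h = cong (rel R) (subTs-fuse y fuses ts h)
  subF-fuse y fuses (fX n X ts) h = cong (fX n X) (subTs-fuse y fuses ts h)
  subF-fuse y fuses (bX p ts) h = cong (bX p) (subTs-fuse y fuses ts h)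
  subF-fuse y fuses (A ⇒ B) h =
    cong₂ _⇒_ (subF-fuse y fuses A (m⊔n<o⇒m<o (boundF A) _ h))
              (subF-fuse y fuses B (m⊔n<o⇒n<o (boundF A) _ h))
  subF-fuse y fuses (∀₁ A) h = cong ∀₁ (subF-fuse y (liftT-fuses y fuses) A h)
  subF-fuse y fuses (∀₂ n A) h = cong (∀₂ n) (subF-fuse y fuses A h)

  mutual
    subT-id : (σ : TSub 0 0) → (∀ z → σ (inj₂ z) ≡ fv z) → (t : Term 0) → subT σ t ≡ t
    subT-id σ fixes (bv ())
    subT-id σ fixes (fv z) = fixes z
    subT-id σ fixes (fn f ts) = cong (fn f) (subTs-id σ fixes ts)

    subTs-id : ∀ {n} (σ : TSub 0 0) → (∀ z → σ (inj₂ z) ≡ fv z) →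
               (ts : Vec (Term 0) n) → subTs σ ts ≡ ts
    subTs-id σ fixes [] = refl
    subTs-id σ fixes (t ∷ ts) = cong₂ _∷_ (subT-id σ fixes t) (subTs-id σ fixes ts)

  emb-id : (t : Term 0) → emb t ≡ t
  emb-id = subT-id _ λ z → refl

  mutual
    sing-fresh : (c : Term 0) (y : ℕ) (t : Term 0) → boundT t < y → subT (sing c y) t ≡ t
    sing-fresh c y (bv ())
    sing-fresh c y (fv z) z<y with z ≟ y
    ... | yes refl = ⊥-elim (<-irrefl refl z<y)
    ... | no _ = refl
    sing-fresh c y (fn f ts) ts<y = cong (fn f) (sing-freshs c y ts ts<y)

    sing-freshs : ∀ {n} (c : Term 0) (y : ℕ) (ts : Vec (Term 0) n) → boundTs ts < y →
                  subTs (sing c y) ts ≡ ts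
    sing-freshs c y [] _ = refl
    sing-freshs c y (t ∷ ts) h =
      cong₂ _∷_ (sing-fresh c y t (m⊔n<o⇒m<o (boundT t) _ h))
                (sing-freshs c y ts (m⊔n<o⇒n<o (boundT t) _ h))

  sing-self : (c : Term 0) (y : ℕ) → subT (sing c y) (fv y) ≡ c
  sing-self c y with y ≟ y
  ... | yes _ = emb-id c
  ... | no y≢y = ⊥-elim (y≢y refl)

  substitution-lemma : (B : Formula 0 []) (s c : Term 0) (x y : ℕ) → boundF B < y →
                       (B [ s / x ]) [ c / y ] ≡ B [ subT (sing c y) s / x ]
  substitution-lemma B s c x y = subF-fuse y fuses B
    where
    open ≡-Reasoning
    fuses : FusesOff y (sing c y) (sing s x) (sing (subT (sing c y) s) x)
    fuses (inj₁ ())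
    fuses (inj₂ z) z≢y with z ≟ x
    ... | yes _ = begin
      subT (sing c y) (emb s)  ≡⟨ cong (subT (sing c y)) (emb-id s) ⟩
      subT (sing c y) s        ≡⟨ sym (emb-id _) ⟩
      emb (subT (sing c y) s)  ∎
    ... | no _ with z ≟ y
    ...   | yes refl = ⊥-elim (z≢y refl)
    ...   | no _ = refl

  -- A way K of building a term of L from n argument terms commutes with
  -- substitution for y; e.g. a function symbol with some arguments fixed.
  CommutesWith : ∀ {n} → ℕ → (Vec (Term 0) n → Term 0) → Set
  CommutesWith y K = ∀ c ts → subT (sing c y) (K ts) ≡ K (subTs (sing c y) ts)

  commutes-fix : ∀ {n} {y} (K : Vec (Term 0) (suc n) → Term 0) (b : Term 0) →
                 CommutesWith y K → boundT b < y → CommutesWith y (λ ts → K (b ∷ ts))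
  commutes-fix {y = y} K b commutes b<y c ts =
    trans (commutes c (b ∷ ts)) (cong (λ b' → K (b' ∷ _)) (sing-fresh c y b b<y))

  plug : ∀ {n} {y} (K : Vec (Term 0) (suc n) → Term 0) → CommutesWith y K →
         (c : Term 0) (ts : Vec (Term 0) n) → boundTs ts < y →
         subT (sing c y) (K (fv y ∷ ts)) ≡ K (c ∷ ts)
  plug {y = y} K commutes c ts ts<y =
    trans (commutes c (fv y ∷ ts))
          (cong₂ (λ c' ts' → K (c' ∷ ts')) (sing-self c y) (sing-freshs c y ts ts<y))

module Replacement (L : Language) (E : Syntax.Term L 0 → Syntax.Term L 0 → Set) where
  open Syntax L
  open AF2 L E
  open Substitution L

  Transportable : Term 0 → Term 0 → Set
  Transportable a b = ∀ {Γ u} (B : Fm) (x : ℕ) → Γ ⊢ u ∶ B [ a / x ] → Γ ⊢ u ∶ B [ b / x ]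

  retype : ∀ {Γ u} {A A' : Fm} → A ≡ A' → Γ ⊢ u ∶ A → Γ ⊢ u ∶ A'
  retype = subst (_ ⊢ _ ∶_)

  transport-inside : ∀ {a b Γ u} → Transportable a b → (B : Fm) (s : Term 0) (x y : ℕ) →
                     boundF B < y → Γ ⊢ u ∶ B [ subT (sing a y) s / x ] →
                     Γ ⊢ u ∶ B [ subT (sing b y) s / x ]
  transport-inside {a} {b} a↝b B s x y B<y d =
    retype (substitution-lemma B s b x y B<y)
      (a↝b (B [ s / x ]) y (retype (sym (substitution-lemma B s a x y B<y)) d))

  -- Replace the arguments of K one at a time, left to right: the first
  -- argument a is a ↦ b inside K(y, as), after which b is frozen into K.
  transport-args : ∀ {n Γ u} {as bs : Vec (Term 0) n} → Pointwise Transportable as bs →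
                   (K : Vec (Term 0) n → Term 0) (B : Fm) (x y : ℕ) → CommutesWith y K →
                   boundF B < y → boundTs as < y → boundTs bs < y →
                   Γ ⊢ u ∶ B [ K as / x ] → Γ ⊢ u ∶ B [ K bs / x ]
  transport-args [] K B x y commutes B<y as<y bs<y d = d
  transport-args {as = a ∷ as} {b ∷ bs} (a↝b ∷ as↝bs) K B x y commutes B<y a∷as<y b∷bs<y d =
    transport-args as↝bs (λ ts → K (b ∷ ts)) B x y (commutes-fix K b commutes b<y) B<y as<y bs<y
      (retype (cong (B [_/ x ]) (plug K commutes b as as<y))
        (transport-inside a↝b B (K (fv y ∷ as)) x y B<y
          (retype (cong (B [_/ x ]) (sym (plug K commutes a as as<y))) d)))
    where
    as<y : boundTs as < y
    as<y = m⊔n<o⇒n<o (boundT a) _ a∷as<y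
    b<y : boundT b < y
    b<y = m⊔n<o⇒m<o (boundT b) _ b∷bs<y
    bs<y : boundTs bs < y
    bs<y = m⊔n<o⇒n<o (boundT b) _ b∷bs<y

  transport-cong : ∀ f {as bs} → Pointwise Transportable as bs → Transportable (fn f as) (fn f bs)
  transport-cong f {as} {bs} as↝bs B x =
    transport-args as↝bs (fn f) B x y (λ c ts → refl) B<y as<y bs<y
    where
    y : ℕ
    y = suc (boundF B ⊔ (boundTs as ⊔ boundTs bs))
    below : boundF B ⊔ (boundTs as ⊔ boundTs bs) < y
    below = s≤s ≤-refl
    B<y : boundF B < y
    B<y = m⊔n<o⇒m<o (boundF B) _ below
    as<y : boundTs as < y
    as<y = m⊔n<o⇒m<o (boundTs as) _ (m⊔n<o⇒n<o (boundF B) _ below)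
    bs<y : boundTs bs < y
    bs<y = m⊔n<o⇒n<o (boundTs as) _ (m⊔n<o⇒n<o (boundF B) _ below)

  mutual
    ≈⇒transportable : ∀ {a b} → a ≈ b → Transportable a b
    ≈⇒transportable (≈-base a=b) B x = eqR B x a=b
    ≈⇒transportable ≈-refl B x d = d
    ≈⇒transportable (≈-trans a≈b b≈c) B x d =
      ≈⇒transportable b≈c B x (≈⇒transportable a≈b B x d)
    ≈⇒transportable (≈-cong f as≈bs) = transport-cong f (≈s⇒transportable as≈bs)

    ≈s⇒transportable : ∀ {n} {as bs : Vec (Term 0) n} →
                       Pointwise _≈_ as bs → Pointwise Transportable as bs
    ≈s⇒transportable [] = []
    ≈s⇒transportable (a≈b ∷ as≈bs) = ≈⇒transportable a≈b ∷ ≈s⇒transportable as≈bs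

lemma1p6 : (L : Language) → let open Syntax L in
    (E : Term 0 → Term 0 → Set) → let open AF2 L E in
    (Γ : Ctx) (u : Λ) (B : Formula 0 []) (x : ℕ) (a b : Term 0) →
    Γ ⊢ u ∶ B [ a / x ] → a ≈ b → Γ ⊢ u ∶ B [ b / x ]
lemma1p6 L E Γ u B x a b d a≈b = Replacement.≈⇒transportable L E a≈b B x d
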